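{- For infinitely many values of $n$, there is a circular interval digraph on $n$ vertices with exactly $n^3/16$ induced $3$-vertex directed paths.
   Context: Digraphs are finite and simple. A digraph $G$ is a circular interval digraph if its vertices can be arranged in a circle such that for every triple $u,v,w$ of distinct vertices in clockwise order, if $uw\in E(G)$ then $uv,vw\in E(G)$. An induced $3$-vertex directed path is an ordered triple $(u,w,v)$ of distinct vertices with $uw,wv\in E(G)$ and neither $uv$ nor $vu$ in $E(G)$. -}

module Defs where

open import Data.Nat using (ℕ; _+_; _<_)
open import Data.Fin using (Fin; toℕ)
open import Data.Fin.Properties using (_≟_)
open import Data.Bool using (Bool; true; false; _∧_; not; if_then_else_)
open import Data.List using (List; map; concatMap; allFin)
open import Data.Nat.ListAction using (sum)
open import Data.Product using (Σ; _×_; _,_)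
open import Data.Sum using (_⊎_)
open import Relation.Nullary using (¬_; does)
open import Relation.Binary.PropositionalEquality using (_≡_)
open import Function.Definitions using (Injective)

-- A finite simple digraph on vertex set Fin n: adjacency given as a Boolean
-- relation (so at most one edge u→v), with no loops.  Antiparallel pairs
-- uv, vu are allowed (as usual for digraphs).
record Digraph (n : ℕ) : Set where
  field
    adj     : Fin n → Fin n → Bool
    loopless : ∀ v → adj v v ≡ false
open Digraph public

Edge : ∀ {n} → Digraph n → Fin n → Fin n → Set
Edge G u v = adj G u v ≡ true

Clockwise : ∀ {n} → (Fin n → Fin n) → Fin n → Fin n → Fin n → Set
Clockwise pos u v w =
  let a = toℕ (pos u) ; b = toℕ (pos v) ; c = toℕ (pos w) in
  (a < b × b < c) ⊎ (b < c × c < a) ⊎ (c < a × a < b)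

-- G is a circular interval digraph: its vertices can be arranged in a
-- circle (an injective, hence bijective, position map) such that for every
-- clockwise triple u, v, w of distinct vertices, uw ∈ E implies uv, vw ∈ E.
CircularInterval : ∀ {n} → Digraph n → Set
CircularInterval {n} G =
  Σ (Fin n → Fin n) λ pos → Injective _≡_ _≡_ pos ×
    (∀ u v w → ¬ u ≡ v → ¬ v ≡ w → ¬ u ≡ w →
      Clockwise pos u v w → Edge G u w → Edge G u v × Edge G v w)

isInducedP3 : ∀ {n} → Digraph n → Fin n → Fin n → Fin n → Bool
isInducedP3 G u w v =
  not (does (u ≟ w)) ∧ not (does (w ≟ v)) ∧ not (does (u ≟ v)) ∧
  adj G u w ∧ adj G w v ∧ not (adj G u v) ∧ not (adj G v u)

numInducedP3 : ∀ {n} → Digraph n → ℕ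
numInducedP3 {n} G =
  sum (concatMap (λ u → concatMap (λ w → map (λ v →
        if isInducedP3 G u w v then 1 else 0) (allFin n)) (allFin n)) (allFin n))

module Submission where

-- G is the blow-up of
-- the directed 4-cycle 0 → 1 → 2 → 3 → 0: each block a ∈ Fin 4 is replaced
-- by a transitive tournament on Fin k, and every vertex of block a has an
-- arc to every vertex of block a + 1 (mod 4).
--
-- Arcs compose except along two consecutive steps of the cycle
-- (arc-compose), so an ordered triple (u, w, v) is an induced path exactly
-- when its blocks form a walk a → a+1 → a+2.  The count therefore depends
-- only on the blocks and equals k³ times the 4 such walks of the 4-cycle.
--
-- Place vertex (a, i) at position k·a + i.  An arc either goes
-- forward in the lexicographic order by at most one block, or wraps from
-- block 3 to block 0; both kinds of arc span circular intervals
-- (arcs-span-intervals).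

open import Defs
open import Data.Nat using (ℕ; _≤_; _*_; _^_)
open import Data.Product using (Σ; _×_)
open import Relation.Binary.PropositionalEquality using (_≡_)

open import Data.Nat as ℕ using (zero; suc; _+_; _<_; z≤n; s≤s)
import Data.Nat.Properties as ℕₚ
import Data.Nat.ListAction as List
open import Data.Nat.ListAction.Properties using (sum-++)
open import Data.Nat.Tactic.RingSolver using (solve-∀)
open import Data.Fin as Fin using (Fin; toℕ; combine; remQuot; _↑ˡ_; _↑ʳ_)
open import Data.Fin.Patterns using (0F; 1F; 2F; 3F)
import Data.Fin.Properties as Finₚ
open import Data.Bool using (Bool; true; false; _∧_; not; if_then_else_)
open import Data.List using (List; []; _∷_; map; concatMap; allFin; tabulate)
open import Data.List.Properties using (map-tabulate)
open import Data.Product using (_,_; proj₁; proj₂)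
open import Data.Product.Relation.Binary.Lex.Strict using (×-Lex; ×-asymmetric)
open import Data.Sum using (_⊎_; inj₁; inj₂)
open import Data.Empty using (⊥-elim)
open import Function using (id; _∘_)
open import Relation.Nullary using (¬_; Dec; yes; no; does; _⊎-dec_; _×-dec_)
open import Relation.Nullary.Decidable using (dec-true; dec-false)
open import Relation.Binary.Definitions using (tri<; tri≈; tri>)
open import Relation.Binary.PropositionalEquality
  using (_≢_; refl; sym; trans; cong; subst; subst₂; module ≡-Reasoning)
open import Algebra.Properties.Semiring.Sum ℕₚ.+-*-semiring
  using (sum-syntax; sum-cong-≗; *-distribˡ-sum)

open ≡-Reasoning

χ : Bool → ℕ
χ b = if b then 1 else 0

∑-const : ∀ n x → ∑[ i < n ] x ≡ n * x
∑-const zero    x = refl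
∑-const (suc n) x = cong (x +_) (∑-const n x)

-- Congruence, stated with the ∑ syntax so that the summands are inferred.
∑-cong : ∀ {n} {f g : Fin n → ℕ} → (∀ i → f i ≡ g i) → ∑[ i < n ] f i ≡ ∑[ i < n ] g i
∑-cong = sum-cong-≗

∑-scale : ∀ {n} c (f : Fin n → ℕ) → ∑[ i < n ] (c * f i) ≡ c * ∑[ i < n ] f i
∑-scale c f = sym (*-distribˡ-sum c f)

∑-++ : ∀ a b (f : Fin (a + b) → ℕ) →
       ∑[ u < a + b ] f u ≡ ∑[ i < a ] f (i ↑ˡ b) + ∑[ j < b ] f (a ↑ʳ j)
∑-++ zero    b f = refl
∑-++ (suc a) b f =
  trans (cong (f 0F +_) (∑-++ a b (f ∘ Fin.suc))) (sym (ℕₚ.+-assoc (f 0F) _ _))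

∑-combine : ∀ m k (f : Fin (m * k) → ℕ) →
            ∑[ u < m * k ] f u ≡ ∑[ a < m ] ∑[ i < k ] f (combine a i)
∑-combine zero    k f = refl
∑-combine (suc m) k f =
  trans (∑-++ k (m * k) f)
        (cong (∑[ i < k ] f (i ↑ˡ (m * k)) +_) (∑-combine m k (λ u → f (k ↑ʳ u))))

blockOf : ∀ {m} k → Fin (m * k) → Fin m
blockOf k u = proj₁ (remQuot k u)

∑-blowup : ∀ m k (f : Fin m → ℕ) →
           ∑[ u < m * k ] f (blockOf k u) ≡ k * ∑[ a < m ] f a
∑-blowup m k f = begin
  ∑[ u < m * k ] f (blockOf k u)
    ≡⟨ ∑-combine m k (f ∘ blockOf k) ⟩
  ∑[ a < m ] ∑[ i < k ] f (blockOf k (combine a i))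
    ≡⟨ ∑-cong {m} (λ a → ∑-cong {k} (λ i → cong (f ∘ proj₁) (Finₚ.remQuot-combine a i))) ⟩
  ∑[ a < m ] ∑[ i < k ] f a
    ≡⟨ ∑-cong {m} (λ a → ∑-const k (f a)) ⟩
  ∑[ a < m ] (k * f a)
    ≡⟨ ∑-scale k f ⟩
  k * ∑[ a < m ] f a ∎

∑-blowup³ : ∀ m k (f : Fin m → Fin m → Fin m → ℕ) →
  ∑[ u < m * k ] ∑[ w < m * k ] ∑[ v < m * k ] f (blockOf k u) (blockOf k w) (blockOf k v)
    ≡ k * (k * (k * ∑[ a < m ] ∑[ b < m ] ∑[ c < m ] f a b c))
∑-blowup³ m k f = begin
  ∑[ u < m * k ] ∑[ w < m * k ] ∑[ v < m * k ] f (block u) (block w) (block v)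
    ≡⟨ ∑-cong {m * k} (λ u → ∑-cong {m * k} (λ w → ∑-blowup m k (f (block u) (block w)))) ⟩
  ∑[ u < m * k ] ∑[ w < m * k ] (k * ∑[ c < m ] f (block u) (block w) c)
    ≡⟨ ∑-cong {m * k} (λ u → ∑-scale k (λ w → ∑[ c < m ] f (block u) (block w) c)) ⟩
  ∑[ u < m * k ] (k * ∑[ w < m * k ] ∑[ c < m ] f (block u) (block w) c)
    ≡⟨ ∑-cong {m * k} (λ u → cong (k *_) (∑-blowup m k (λ b → ∑[ c < m ] f (block u) b c))) ⟩
  ∑[ u < m * k ] (k * (k * ∑[ b < m ] ∑[ c < m ] f (block u) b c))
    ≡⟨ ∑-blowup m k (λ a → k * (k * ∑[ b < m ] ∑[ c < m ] f a b c)) ⟩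
  k * ∑[ a < m ] (k * (k * ∑[ b < m ] ∑[ c < m ] f a b c))
    ≡⟨ cong (k *_) (trans (∑-scale k (λ a → k * ∑[ b < m ] ∑[ c < m ] f a b c))
                          (cong (k *_) (∑-scale k (λ a → ∑[ b < m ] ∑[ c < m ] f a b c)))) ⟩
  k * (k * (k * ∑[ a < m ] ∑[ b < m ] ∑[ c < m ] f a b c)) ∎
  where
  block : Fin (m * k) → Fin m
  block = blockOf k

sum-tabulate : ∀ n (f : Fin n → ℕ) → List.sum (tabulate f) ≡ ∑[ i < n ] f i
sum-tabulate zero    f = refl
sum-tabulate (suc n) f = cong (f 0F +_) (sum-tabulate n (f ∘ Fin.suc))

sum-allFin : ∀ n (f : Fin n → ℕ) → List.sum (map f (allFin n)) ≡ ∑[ i < n ] f i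
sum-allFin n f = trans (cong List.sum (map-tabulate id f)) (sum-tabulate n f)

sum-concatMap : ∀ {A : Set} (g : A → List ℕ) (xs : List A) →
                List.sum (concatMap g xs) ≡ List.sum (map (List.sum ∘ g) xs)
sum-concatMap g []       = refl
sum-concatMap g (x ∷ xs) =
  trans (sum-++ (g x) (concatMap g xs)) (cong (List.sum (g x) +_) (sum-concatMap g xs))

sum-concatMap-allFin : ∀ n (g : Fin n → List ℕ) →
                       List.sum (concatMap g (allFin n)) ≡ ∑[ i < n ] List.sum (g i)
sum-concatMap-allFin n g = trans (sum-concatMap g (allFin n)) (sum-allFin n (List.sum ∘ g))

numInducedP3-∑ : ∀ {n} (G : Digraph n) →
  numInducedP3 G ≡ ∑[ u < n ] ∑[ w < n ] ∑[ v < n ] χ (isInducedP3 G u w v)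
numInducedP3-∑ {n} G =
  trans (sum-concatMap-allFin n _) (∑-cong {n} (λ u →
  trans (sum-concatMap-allFin n _) (∑-cong {n} (λ w →
  sum-allFin n (λ v → χ (isInducedP3 G u w v))))))

∧-false₄ : ∀ p q r → p ∧ q ∧ r ∧ false ≡ false
∧-false₄ false q     r     = refl
∧-false₄ true  false r     = refl
∧-false₄ true  true  false = refl
∧-false₄ true  true  true  = refl

inducedP3-closed : ∀ {n} (G : Digraph n) u w v →
  (Edge G u w → Edge G w v → Edge G u v) → isInducedP3 G u w v ≡ false
inducedP3-closed G u w v closes =
  path-closed {not (does (u Finₚ.≟ w))} {not (does (w Finₚ.≟ v))} {not (does (u Finₚ.≟ v))}
              {not (adj G v u)} (adj G u w) (adj G w v) (adj G u v) closes
  where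
  path-closed : ∀ {p q r t} x y z → (x ≡ true → y ≡ true → z ≡ true) →
                p ∧ q ∧ r ∧ x ∧ y ∧ not z ∧ t ≡ false
  path-closed {p} {q} {r} false y     z _ = ∧-false₄ p q r
  path-closed {p} {q} {r} true  false z _ = ∧-false₄ p q r
  path-closed {p} {q} {r} true  true  z forces rewrite forces refl refl = ∧-false₄ p q r

inducedP3-holds : ∀ {n} (G : Digraph n) {u w v} → u ≢ w → w ≢ v → u ≢ v →
  Edge G u w → Edge G w v → adj G u v ≡ false → adj G v u ≡ false →
  isInducedP3 G u w v ≡ true
inducedP3-holds G {u} {w} {v} u≢w w≢v u≢v uw wv ¬uv ¬vu =
  all-hold (dec-false (u Finₚ.≟ w) u≢w) (dec-false (w Finₚ.≟ v) w≢v)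
           (dec-false (u Finₚ.≟ v) u≢v) uw wv ¬uv ¬vu
  where
  all-hold : ∀ {p q r x y z t} → p ≡ false → q ≡ false → r ≡ false →
             x ≡ true → y ≡ true → z ≡ false → t ≡ false →
             not p ∧ not q ∧ not r ∧ x ∧ y ∧ not z ∧ not t ≡ true
  all-hold refl refl refl refl refl refl refl = refl

does-true : ∀ {P : Set} (d : Dec P) → does d ≡ true → P
does-true (yes p) _ = p
does-true (no _) ()

next : Fin 4 → Fin 4
next 0F = 1F
next 1F = 2F
next 2F = 3F
next 3F = 0F

next¹-≢ : ∀ a → next a ≢ a
next¹-≢ 0F ()
next¹-≢ 1F ()
next¹-≢ 2F ()
next¹-≢ 3F ()

next²-≢ : ∀ a → next (next a) ≢ a
next²-≢ 0F ()
next²-≢ 1F ()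
next²-≢ 2F ()
next²-≢ 3F ()

next³-≢ : ∀ a → next (next (next a)) ≢ a
next³-≢ 0F ()
next³-≢ 1F ()
next³-≢ 2F ()
next³-≢ 3F ()

next-forward : ∀ a → (toℕ a < toℕ (next a) × toℕ (next a) ≤ suc (toℕ a))
                     ⊎ (a ≡ 3F × next a ≡ 0F)
next-forward 0F = inj₁ (ℕₚ.≤-refl , ℕₚ.≤-refl)
next-forward 1F = inj₁ (ℕₚ.≤-refl , ℕₚ.≤-refl)
next-forward 2F = inj₁ (ℕₚ.≤-refl , ℕₚ.≤-refl)
next-forward 3F = inj₂ (refl , refl)

next-of-successor : ∀ a b → toℕ b ≡ suc (toℕ a) → b ≡ next a
next-of-successor 0F 1F refl = refl
next-of-successor 1F 2F refl = refl
next-of-successor 2F 3F refl = refl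
next-of-successor 3F b  b≡4  = ⊥-elim (ℕₚ.<-irrefl b≡4 (Finₚ.toℕ<n b))

TwoSteps : Fin 4 → Fin 4 → Fin 4 → Set
TwoSteps a b c = b ≡ next a × c ≡ next b

twoSteps? : ∀ a b c → Dec (TwoSteps a b c)
twoSteps? a b c = (b Finₚ.≟ next a) ×-dec (c Finₚ.≟ next b)

_≺_ : ∀ {m k} → Fin m × Fin k → Fin m × Fin k → Set
_≺_ = ×-Lex _≡_ Fin._<_ Fin._<_

≺-asym : ∀ {m k} {x y : Fin m × Fin k} → x ≺ y → ¬ y ≺ x
≺-asym {m} {k} = ×-asymmetric {_≈₁_ = _≡_} {_<₁_ = Fin._<_ {m}} {_<₂_ = Fin._<_ {k}}
                   sym Finₚ.<-resp₂-≡ Finₚ.<-asym Finₚ.<-asym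

block-mono : ∀ {m k} {x y : Fin m × Fin k} → x ≺ y → toℕ (proj₁ x) ≤ toℕ (proj₁ y)
block-mono (inj₁ a<b)      = ℕₚ.<⇒≤ a<b
block-mono (inj₂ (a≡b , _)) = ℕₚ.≤-reflexive (cong toℕ a≡b)

combine-reflects-≺ : ∀ {m k} (a b : Fin m) (i j : Fin k) →
                     combine a i Fin.< combine b j → (a , i) ≺ (b , j)
combine-reflects-≺ {k = k} a b i j lt with Finₚ.<-cmp a b
... | tri< a<b _ _ = inj₁ a<b
... | tri≈ _ refl _ = inj₂ (refl , ℕₚ.+-cancelˡ-< (k * toℕ a) (toℕ i) (toℕ j)
        (subst₂ _<_ (Finₚ.toℕ-combine a i) (Finₚ.toℕ-combine a j) lt))
... | tri> _ _ b<a = ⊥-elim (ℕₚ.<-asym lt (Finₚ.combine-monoˡ-< j i b<a))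

remQuot-reflects-< : ∀ {m} k {u v : Fin (m * k)} → u Fin.< v → remQuot {m} k u ≺ remQuot k v
remQuot-reflects-< {m} k {u} {v} u<v = combine-reflects-≺ _ _ _ _
  (subst₂ Fin._<_ (sym (Finₚ.combine-remQuot {m} k u)) (sym (Finₚ.combine-remQuot {m} k v)) u<v)

Cyclic : ∀ {A : Set} → (A → A → Set) → A → A → A → Set
Cyclic _⊏_ x y z = (x ⊏ y × y ⊏ z) ⊎ (y ⊏ z × z ⊏ x) ⊎ (z ⊏ x × x ⊏ y)

cyclic-map : ∀ {A B : Set} {_⊏_ : A → A → Set} {_⊏′_ : B → B → Set} (f : A → B) →
  (∀ {x y} → x ⊏ y → f x ⊏′ f y) → ∀ {x y z} → Cyclic _⊏_ x y z → Cyclic _⊏′_ (f x) (f y) (f z)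
cyclic-map f mono (inj₁ (p , q))        = inj₁ (mono p , mono q)
cyclic-map f mono (inj₂ (inj₁ (p , q))) = inj₂ (inj₁ (mono p , mono q))
cyclic-map f mono (inj₂ (inj₂ (p , q))) = inj₂ (inj₂ (mono p , mono q))

module BlowUp (k : ℕ) where

  Vertex : Set
  Vertex = Fin 4 × Fin k

  Arc : Vertex → Vertex → Set
  Arc (a , i) (b , j) = b ≡ next a ⊎ (a ≡ b × i Fin.< j)

  arc? : ∀ x y → Dec (Arc x y)
  arc? (a , i) (b , j) = (b Finₚ.≟ next a) ⊎-dec ((a Finₚ.≟ b) ×-dec (i Fin.<? j))

  no-loop : ∀ x → ¬ Arc x x
  no-loop (a , i) (inj₁ a≡next) = next¹-≢ a (sym a≡next)
  no-loop (a , i) (inj₂ (_ , i<i)) = ℕₚ.<-irrefl refl i<i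

  arc-compose : ∀ (x y z : Vertex) → Arc x y → Arc y z → Arc x z ⊎ TwoSteps (proj₁ x) (proj₁ y) (proj₁ z)
  arc-compose x y z (inj₁ p)           (inj₁ q)           = inj₂ (p , q)
  arc-compose x y z (inj₁ p)           (inj₂ (b≡c , _))   = inj₁ (inj₁ (trans (sym b≡c) p))
  arc-compose x y z (inj₂ (refl , _))  (inj₁ q)           = inj₁ (inj₁ q)
  arc-compose x y z (inj₂ (refl , i<j)) (inj₂ (refl , j<l)) = inj₁ (inj₂ (refl , ℕₚ.<-trans i<j j<l))

  two-steps-distinct : ∀ a b c → TwoSteps a b c → a ≢ b × b ≢ c × a ≢ c
  two-steps-distinct a _ _ (refl , refl) =
    next¹-≢ a ∘ sym , next¹-≢ (next a) ∘ sym , next²-≢ a ∘ sym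

  two-steps-no-arcs : ∀ (x y z : Vertex) → TwoSteps (proj₁ x) (proj₁ y) (proj₁ z) → ¬ Arc x z × ¬ Arc z x
  two-steps-no-arcs (a , i) (_ , j) (_ , l) (refl , refl) = no-forward , no-backward
    where
    no-forward : ¬ Arc (a , i) (next (next a) , l)
    no-forward (inj₁ e)       = next¹-≢ (next a) e
    no-forward (inj₂ (e , _)) = next²-≢ a (sym e)
    no-backward : ¬ Arc (next (next a) , l) (a , i)
    no-backward (inj₁ e)       = next³-≢ a (sym e)
    no-backward (inj₂ (e , _)) = next²-≢ a e

  n : ℕ
  n = 4 * k

  split : Fin n → Vertex
  split = remQuot k

  block : Fin n → Fin 4
  block = blockOf k

  G : Digraph n
  G = record
    { adj      = λ u v → does (arc? (split u) (split v))
    ; loopless = λ v → dec-false (arc? (split v) (split v)) (no-loop (split v))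
    }

  edge⇒arc : ∀ {u v} → Edge G u v → Arc (split u) (split v)
  edge⇒arc {u} {v} = does-true (arc? (split u) (split v))

  arc⇒edge : ∀ {u v} → Arc (split u) (split v) → Edge G u v
  arc⇒edge {u} {v} = dec-true (arc? (split u) (split v))

  inducedP3-classify : ∀ u w v →
    isInducedP3 G u w v ≡ does (twoSteps? (block u) (block w) (block v))
  inducedP3-classify u w v = classify (twoSteps? (block u) (block w) (block v))
    where
    classify : (d : Dec (TwoSteps (block u) (block w) (block v))) → isInducedP3 G u w v ≡ does d
    classify (yes two) =
      let (a≢b , b≢c , a≢c) = two-steps-distinct _ _ _ two
          (no-uv , no-vu)   = two-steps-no-arcs (split u) (split w) (split v) two
      in inducedP3-holds G (a≢b ∘ cong block) (b≢c ∘ cong block) (a≢c ∘ cong block)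
           (arc⇒edge (inj₁ (proj₁ two))) (arc⇒edge (inj₁ (proj₂ two)))
           (dec-false (arc? (split u) (split v)) no-uv) (dec-false (arc? (split v) (split u)) no-vu)
    classify (no ¬two) = inducedP3-closed G u w v (λ uw wv →
      closes (arc-compose (split u) (split w) (split v) (edge⇒arc uw) (edge⇒arc wv)))
      where
      closes : Arc (split u) (split v) ⊎ TwoSteps (block u) (block w) (block v) → Edge G u v
      closes (inj₁ uv)  = arc⇒edge uv
      closes (inj₂ two) = ⊥-elim (¬two two)

  count : numInducedP3 G ≡ k * (k * (k * 4))
  count = begin
    numInducedP3 G
      ≡⟨ numInducedP3-∑ G ⟩
    ∑[ u < n ] ∑[ w < n ] ∑[ v < n ] χ (isInducedP3 G u w v)
      ≡⟨ ∑-cong {n} (λ u → ∑-cong {n} (λ w → ∑-cong {n} (λ v →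
           cong χ (inducedP3-classify u w v)))) ⟩
    ∑[ u < n ] ∑[ w < n ] ∑[ v < n ] walks (block u) (block w) (block v)
      ≡⟨ ∑-blowup³ 4 k walks ⟩
    k * (k * (k * ∑[ a < 4 ] ∑[ b < 4 ] ∑[ c < 4 ] walks a b c))
      ≡⟨⟩  -- the 4-cycle has exactly 4 walks of length two
    k * (k * (k * 4)) ∎
    where
    walks : Fin 4 → Fin 4 → Fin 4 → ℕ
    walks a b c = χ (does (twoSteps? a b c))

  Forward : Vertex → Vertex → Set
  Forward x y = x ≺ y × toℕ (proj₁ y) ≤ suc (toℕ (proj₁ x))

  Wraps : Vertex → Vertex → Set
  Wraps x y = proj₁ x ≡ 3F × proj₁ y ≡ 0F

  arc⇒forward⊎wraps : ∀ x y → Arc x y → Forward x y ⊎ Wraps x y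
  arc⇒forward⊎wraps (a , i) (b , j) (inj₁ refl) with next-forward a
  ... | inj₁ (a<b , b≤1+a) = inj₁ (inj₁ a<b , b≤1+a)
  ... | inj₂ wraps         = inj₂ wraps
  arc⇒forward⊎wraps (a , i) (b , j) (inj₂ (refl , i<j)) = inj₁ (inj₂ (refl , i<j) , ℕₚ.n≤1+n _)

  forward⇒arc : ∀ x y → Forward x y → Arc x y
  forward⇒arc (a , i) (b , j) (inj₁ a<b , b≤1+a) =
    inj₁ (next-of-successor a b (ℕₚ.≤-antisym b≤1+a a<b))
  forward⇒arc (a , i) (b , j) (inj₂ same-block , _) = inj₂ same-block

  wraps⇒arc : ∀ x y → Wraps x y → Arc x y
  wraps⇒arc (_ , i) (_ , j) (refl , refl) = inj₁ refl

  arcs-span-intervals : ∀ x y z → Cyclic _≺_ x y z → Arc x z → Arc x y × Arc y z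
  arcs-span-intervals x y z cyc xz with arc⇒forward⊎wraps x z xz | cyc
  ... | inj₁ (_ , z≤1+x) | inj₁ (x≺y , y≺z) =
    forward⇒arc x y (x≺y , ℕₚ.≤-trans (block-mono y≺z) z≤1+x) ,
    forward⇒arc y z (y≺z , ℕₚ.≤-trans z≤1+x (s≤s (block-mono x≺y)))
  ... | inj₁ (x≺z , _) | inj₂ (inj₁ (_ , z≺x)) = ⊥-elim (≺-asym x≺z z≺x)
  ... | inj₁ (x≺z , _) | inj₂ (inj₂ (z≺x , _)) = ⊥-elim (≺-asym x≺z z≺x)
  ... | inj₂ (x≡3 , z≡0) | inj₁ (x≺y , y≺z) = ⊥-elim (ℕₚ.n≮0 {2} 3≤0)
    where
    3≤0 : 3 ≤ 0
    3≤0 = subst₂ _≤_ (cong toℕ x≡3) (cong toℕ z≡0)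
            (ℕₚ.≤-trans (block-mono x≺y) (block-mono y≺z))
  ... | inj₂ (x≡3 , z≡0) | inj₂ (inj₁ (y≺z , _)) =
    wraps⇒arc x y (x≡3 , y≡0) ,
    forward⇒arc y z (y≺z , subst (_≤ suc (toℕ (proj₁ y))) (sym (cong toℕ z≡0)) z≤n)
    where
    y≡0 : proj₁ y ≡ 0F
    y≡0 = Finₚ.toℕ-injective (ℕₚ.n≤0⇒n≡0 (subst (toℕ (proj₁ y) ≤_) (cong toℕ z≡0) (block-mono y≺z)))
  ... | inj₂ (x≡3 , z≡0) | inj₂ (inj₂ (_ , x≺y)) =
    forward⇒arc x y (x≺y , subst (λ a → toℕ (proj₁ y) ≤ suc (toℕ a)) (sym x≡3)
                              (ℕₚ.<⇒≤ (Finₚ.toℕ<n (proj₁ y)))) ,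
    wraps⇒arc y z (y≡3 , z≡0)
    where
    y≡3 : proj₁ y ≡ 3F
    y≡3 = Finₚ.toℕ-injective (ℕₚ.≤-antisym (ℕₚ.≤-pred (Finₚ.toℕ<n (proj₁ y)))
            (subst (_≤ toℕ (proj₁ y)) (cong toℕ x≡3) (block-mono x≺y)))

  circular : CircularInterval G
  circular = id , id , λ u v w _ _ _ cw uw →
    let (uv , vw) = arcs-span-intervals (split u) (split v) (split w)
                      (cyclic-map {_⊏′_ = _≺_} split (remQuot-reflects-< k) cw) (edge⇒arc uw)
    in arc⇒edge uv , arc⇒edge vw

-- (4k)³ unfolds to a product, which the ring solver normalises.
16·4k³≡[4k]³ : ∀ k → 16 * (k * (k * (k * 4))) ≡ (4 * k) ^ 3
16·4k³≡[4k]³ = expanded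
  where
  expanded : ∀ k → 16 * (k * (k * (k * 4))) ≡ 4 * k * (4 * k * (4 * k * 1))
  expanded = solve-∀

lemma3p2 : (m : ℕ) → Σ ℕ λ n → m ≤ n × Σ (Digraph n) λ G →
    CircularInterval G × 16 * numInducedP3 G ≡ n ^ 3
lemma3p2 m = 4 * m , ℕₚ.m≤m+n m (3 * m) , G , circular ,
  trans (cong (16 *_) count) (16·4k³≡[4k]³ m)
  where open BlowUp m
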